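{- For $n=5,6,7$, $\mathrm{bet}(n)=5$.
   Context: An ordering of $[n]$ is a bijection $\phi:[n]\to[n]$. A ternary constraint is a triple $(x_1,x_2,x_3)$ of distinct elements of $[n]$. $\phi$ between-satisfies the constraint if $\phi(x_1)<\phi(x_2)<\phi(x_3)$ or $\phi(x_3)<\phi(x_2)<\phi(x_1)$. $\mathrm{bet}(n)$ is the minimum size of a set of orderings of $[n]$ such that every ternary constraint is between-satisfied by some ordering in the set. -}

module Defs where

open import Data.Nat using (ℕ; _≤_)
open import Data.Fin using (Fin; _<_)
open import Data.Fin.Permutation using (Permutation′; _⟨$⟩ʳ_)
open import Data.Product using (_×_; Σ; ∃)
open import Data.Sum using (_⊎_)
open import Relation.Binary.PropositionalEquality using (_≡_; _≢_)

Ordering : ℕ → Set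
Ordering n = Permutation′ n

record Constraint (n : ℕ) : Set where
  constructor triple
  field
    x₁ x₂ x₃ : Fin n
    x₁≢x₂ : x₁ ≢ x₂
    x₁≢x₃ : x₁ ≢ x₃
    x₂≢x₃ : x₂ ≢ x₃

BetSat : {n : ℕ} → Ordering n → Constraint n → Set
BetSat φ (triple x₁ x₂ x₃ _ _ _) =
  ((φ ⟨$⟩ʳ x₁) < (φ ⟨$⟩ʳ x₂) × (φ ⟨$⟩ʳ x₂) < (φ ⟨$⟩ʳ x₃))
  ⊎ ((φ ⟨$⟩ʳ x₃) < (φ ⟨$⟩ʳ x₂) × (φ ⟨$⟩ʳ x₂) < (φ ⟨$⟩ʳ x₁))

SameOrdering : {n : ℕ} → Ordering n → Ordering n → Set
SameOrdering {n} φ ψ = (i : Fin n) → φ ⟨$⟩ʳ i ≡ ψ ⟨$⟩ʳ i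

-- A set of k orderings of [n]: an enumeration Fin k → Ordering n
-- with pairwise distinct members (so the set has exactly k elements).
record OrderingSet (n k : ℕ) : Set where
  field
    member   : Fin k → Ordering n
    distinct : (i j : Fin k) → SameOrdering (member i) (member j) → i ≡ j

open OrderingSet public

Covers : {n k : ℕ} → OrderingSet n k → Set
Covers {n} {k} S = (c : Constraint n) → ∃ λ (i : Fin k) → BetSat (member S i) c

IsBet : ℕ → ℕ → Set
IsBet n m =
  (Σ (OrderingSet n m) Covers)
  × ((k : ℕ) (S : OrderingSet n k) → Covers S → m ≤ k)

-- Upper bound: five explicit orderings of [n] for n = 5, 6, 7, checked by exhaustive search.
--
-- Lower bound: suppose four orderings of [n], n ≥ 5, between-satisfy every constraint, and look
-- at five of the points only. In an ordering, the height of a point x is the number of the other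
-- four points below x; give x the weight w(height) with w(0), …, w(4) = 0, 2, 3, 2, 0. The five
-- heights in one ordering are 0, …, 4, so each ordering contributes weight 7, at most 28 in all.
-- On the other hand, for distinct p, q ≠ x the constraint (p, x, q) puts p and q on opposite sides
-- of x in some ordering, so the 4 × 4 table "the k-th other point lies below x in ordering j" has
-- pairwise distinct columns; every such table has total row weight at least 6, so the five points
-- receive weight at least 30. Both facts about w are finite checks. Fewer than four orderings are
-- reduced to four by repeating one of them.

module Submission where

open import Algebra.Properties.CommutativeMonoid.Sum using ()
open import Data.Bool.Base using (Bool; true; false; not; _∧_; _∨_; _xor_; if_then_else_)
open import Data.Bool.Properties using (∧-conicalˡ; ∧-conicalʳ; ∨-zeroʳ; T-≡)
open import Data.Empty using (⊥-elim)
open import Data.Fin.Base using (Fin; zero; suc; toℕ; fromℕ<; inject≤; punchIn; _<_)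
open import Data.Fin.Patterns using (0F; 1F; 2F; 3F; 4F; 5F; 6F)
open import Data.Fin.Permutation using (_⟨$⟩ʳ_; permutation)
open import Data.Fin.Properties
  using (_≟_; _<?_; all?; any?; <-cmp; <-irrefl; <-asym; <-trans; suc-injective; punchInᵢ≢i
        ; punchIn-injective; inject≤-injective; toℕ-inject≤; toℕ<n; toℕ≤pred[n]; fromℕ<-cong; fromℕ<-toℕ)
open import Data.Nat.Base using (ℕ; zero; suc; _≤_; _≤ᵇ_; _⊓_; s≤s; z≤n)
open import Data.Nat.Properties
  using (+-0-commutativeMonoid; _≤?_; ≤ᵇ⇒≤; +-mono-≤; m⊓n≤n; m≤n⇒m⊓n≡m; ≤⇒≯; ≰⇒>; m≤m+n; n≤1+n; module ≤-Reasoning)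
open import Data.Product using (Σ; ∃; _×_; _,_; proj₁; proj₂)
open import Data.Sum using (_⊎_; inj₁; inj₂)
open import Data.Unit using (⊤; tt)
open import Data.Vec.Base using (Vec; []; _∷_; lookup; tabulate)
open import Data.Vec.Properties using (lookup∘tabulate)
open import Function.Base using (_∘_)
open import Function.Bundles using (Equivalence; Injection)
open import Function.Definitions using (Injective)
open import Function.Properties.Inverse using (↔⇒↣)
open import Relation.Binary.Definitions using (tri<; tri≈; tri>)
open import Relation.Binary.PropositionalEquality using (_≡_; _≢_; refl; sym; trans; cong; cong₂; subst)
open import Relation.Nullary using (¬_; Dec; yes; no; does)
open import Relation.Nullary.Decidable using (True; toWitness; dec-true; dec-false; ¬?; _×-dec_; _⊎-dec_; _→-dec_)
open import Relation.Nullary.Negation using (contradiction)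

open import Defs

open Algebra.Properties.CommutativeMonoid.Sum +-0-commutativeMonoid using (sum-syntax; sum-cong-≗; ∑-comm)

infixr 1 _⇒ᵇ_

_⇒ᵇ_ : Bool → Bool → Bool
a ⇒ᵇ b = if a then b else true

⇒ᵇ-elim : ∀ {a b} → (a ⇒ᵇ b) ≡ true → a ≡ true → b ≡ true
⇒ᵇ-elim a⇒b refl = a⇒b

⇒ᵇ-intro : ∀ {a b} → (a ≡ true → b ≡ true) → (a ⇒ᵇ b) ≡ true
⇒ᵇ-intro {true}  a→b = a→b refl
⇒ᵇ-intro {false} _   = refl

≢⇒xor≡true : ∀ {a b} → a ≢ b → (a xor b) ≡ true
≢⇒xor≡true {true}  {true}  a≢b = contradiction refl a≢b
≢⇒xor≡true {true}  {false} _   = refl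
≢⇒xor≡true {false} {true}  _   = refl
≢⇒xor≡true {false} {false} a≢b = contradiction refl a≢b

allFinᵇ : ∀ {m} → (Fin m → Bool) → Bool
allFinᵇ {zero}  f = true
allFinᵇ {suc m} f = f zero ∧ allFinᵇ (f ∘ suc)

allFinᵇ-complete : ∀ {m} (f : Fin m → Bool) → (∀ i → f i ≡ true) → allFinᵇ f ≡ true
allFinᵇ-complete {zero}  f all = refl
allFinᵇ-complete {suc m} f all = cong₂ _∧_ (all zero) (allFinᵇ-complete (f ∘ suc) (all ∘ suc))

anyFinᵇ : ∀ {m} → (Fin m → Bool) → Bool
anyFinᵇ {zero}  f = false
anyFinᵇ {suc m} f = f zero ∨ anyFinᵇ (f ∘ suc)

anyFinᵇ-complete : ∀ {m} (f : Fin m → Bool) → ∃ (λ i → f i ≡ true) → anyFinᵇ f ≡ true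
anyFinᵇ-complete f (zero  , fi) = cong (_∨ anyFinᵇ (f ∘ suc)) fi
anyFinᵇ-complete f (suc i , fi) =
  trans (cong (f zero ∨_) (anyFinᵇ-complete (f ∘ suc) (i , fi))) (∨-zeroʳ (f zero))

-- Searches are stated with _≡ true rather than T: a type T b makes the conversion checker
-- evaluate b, and b may be a search over 2^16 cases.
record Exhaustible (A : Set) : Set where
  field
    allᵇ       : (A → Bool) → Bool
    allᵇ-sound : ∀ f → allᵇ f ≡ true → ∀ a → f a ≡ true

open Exhaustible

exhaustible-⊤ : Exhaustible ⊤
exhaustible-⊤ = record { allᵇ = λ f → f tt ; allᵇ-sound = λ f all → λ { tt → all } }

exhaustible-Bool : Exhaustible Bool
exhaustible-Bool = record { allᵇ = λ f → f true ∧ f false ; allᵇ-sound = sound }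
  where
  sound : ∀ f → (f true ∧ f false) ≡ true → ∀ b → f b ≡ true
  sound f all true  = ∧-conicalˡ (f true) (f false) all
  sound f all false = ∧-conicalʳ (f true) (f false) all

exhaustible-× : ∀ {A B} → Exhaustible A → Exhaustible B → Exhaustible (A × B)
exhaustible-× ∀A ∀B = record
  { allᵇ       = λ f → allᵇ ∀A λ a → allᵇ ∀B λ b → f (a , b)
  ; allᵇ-sound = λ f all → λ { (a , b) → allᵇ-sound ∀B _ (allᵇ-sound ∀A _ all a) b }
  }

exhaustible-Vec : ∀ {A} → Exhaustible A → ∀ m → Exhaustible (Vec A m)
exhaustible-Vec ∀A zero    = record { allᵇ = λ f → f [] ; allᵇ-sound = λ f all → λ { [] → all } }
exhaustible-Vec ∀A (suc m) = record
  { allᵇ       = λ f → allᵇ ∀A λ a → allᵇ ∀Vec λ v → f (a ∷ v)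
  ; allᵇ-sound = λ f all → λ { (a ∷ v) → allᵇ-sound ∀Vec _ (allᵇ-sound ∀A _ all a) v }
  }
  where ∀Vec = exhaustible-Vec ∀A m

≤ᵇ≡true⇒≤ : ∀ m n → (m ≤ᵇ n) ≡ true → m ≤ n
≤ᵇ≡true⇒≤ m n m≤ᵇn = ≤ᵇ⇒≤ m n (Equivalence.from T-≡ m≤ᵇn)

-- Tables with separated columns

weight : ℕ → ℕ
weight 1 = 2
weight 2 = 3
weight 3 = 2
weight _ = 0

count : ∀ {m} → (Fin m → Bool) → ℕ
count {m} f = ∑[ i < m ] (if f i then 1 else 0)

count-cong : ∀ {m} {f g : Fin m → Bool} → (∀ i → f i ≡ g i) → count f ≡ count g
count-cong f≗g = sum-cong-≗ (λ i → cong (λ b → if b then 1 else 0) (f≗g i))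

ColumnsSeparated : ∀ {r c} → (Fin r → Fin c → Bool) → Set
ColumnsSeparated u = ∀ {p q} → p ≢ q → ∃ λ j → u j p ≢ u j q

columnsSeparated-resp : ∀ {r c} {u v : Fin r → Fin c → Bool} →
                        (∀ j k → u j k ≡ v j k) → ColumnsSeparated u → ColumnsSeparated v
columnsSeparated-resp u≗v separated p≢q =
  let j , differ = separated p≢q
  in  j , λ same → differ (trans (u≗v j _) (trans same (sym (u≗v j _))))

columnsDifferᵇ : ∀ {r c} → (Fin r → Fin (suc c) → Bool) → Fin (suc c) → Fin c → Bool
columnsDifferᵇ u p q = anyFinᵇ λ j → u j p xor u j (punchIn p q)

columnsSeparatedᵇ : ∀ {r c} → (Fin r → Fin (suc c) → Bool) → Bool
columnsSeparatedᵇ u = allFinᵇ λ p → allFinᵇ (columnsDifferᵇ u p)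

columnsSeparatedᵇ-complete : ∀ {r c} (u : Fin r → Fin (suc c) → Bool) →
                             ColumnsSeparated u → columnsSeparatedᵇ u ≡ true
columnsSeparatedᵇ-complete u separated =
  allFinᵇ-complete (λ p → allFinᵇ (columnsDifferᵇ u p)) λ p →
  allFinᵇ-complete (columnsDifferᵇ u p) λ q →
    let j , differ = separated (punchInᵢ≢i p q ∘ sym)
    in  anyFinᵇ-complete (λ j → u j p xor u j (punchIn p q)) (j , ≢⇒xor≡true differ)

tableWeight : ∀ {r c} → (Fin r → Fin c → Bool) → ℕ
tableWeight {r} u = ∑[ j < r ] weight (count (u j))

tableWeight-cong : ∀ {r c} {u v : Fin r → Fin c → Bool} →
                   (∀ j k → u j k ≡ v j k) → tableWeight u ≡ tableWeight v
tableWeight-cong u≗v = sum-cong-≗ (λ j → cong weight (count-cong (u≗v j)))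

entries : ∀ {r c} → Vec (Vec Bool c) r → Fin r → Fin c → Bool
entries t j k = lookup (lookup t j) k

entries-tabulate : ∀ {r c} (u : Fin r → Fin c → Bool) j k → entries (tabulate (tabulate ∘ u)) j k ≡ u j k
entries-tabulate u j k =
  trans (cong (λ row → lookup row k) (lookup∘tabulate (tabulate ∘ u) j)) (lookup∘tabulate (u j) k)

heavyIfSeparatedᵇ : Vec (Vec Bool 4) 4 → Bool
heavyIfSeparatedᵇ t = columnsSeparatedᵇ (entries t) ⇒ᵇ 6 ≤ᵇ tableWeight (entries t)

tables4×4 : Exhaustible (Vec (Vec Bool 4) 4)
tables4×4 = exhaustible-Vec (exhaustible-Vec exhaustible-Bool 4) 4

all-heavyIfSeparated : allᵇ tables4×4 heavyIfSeparatedᵇ ≡ true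
all-heavyIfSeparated = refl

columnsSeparated⇒6≤tableWeight : (u : Fin 4 → Fin 4 → Bool) → ColumnsSeparated u → 6 ≤ tableWeight u
columnsSeparated⇒6≤tableWeight u separated =
  subst (6 ≤_) (tableWeight-cong (entries-tabulate u)) (≤ᵇ≡true⇒≤ 6 (tableWeight (entries t))
    (⇒ᵇ-elim (allᵇ-sound tables4×4 heavyIfSeparatedᵇ all-heavyIfSeparated t)
             (columnsSeparatedᵇ-complete (entries t)
               (columnsSeparated-resp (λ j k → sym (entries-tabulate u j k)) separated))))
  where t = tabulate (tabulate ∘ u)

-- Strict total orders on five points

-- Only the m(m-1)/2 comparisons above the diagonal are stored; for m = 5 that is 2^10 cases.
Tournament : ℕ → Set
Tournament zero    = ⊤
Tournament (suc m) = Vec Bool m × Tournament m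

toRelation : ∀ {m} → Tournament m → Fin m → Fin m → Bool
toRelation (r , t) zero    zero    = false
toRelation (r , t) zero    (suc b) = lookup r b
toRelation (r , t) (suc a) zero    = not (lookup r a)
toRelation (r , t) (suc a) (suc b) = toRelation t a b

toTournament : ∀ {m} → (Fin m → Fin m → Bool) → Tournament m
toTournament {zero}  R = tt
toTournament {suc m} R = tabulate (R zero ∘ suc) , toTournament (λ a b → R (suc a) (suc b))

exhaustible-Tournament : ∀ m → Exhaustible (Tournament m)
exhaustible-Tournament zero    = exhaustible-⊤
exhaustible-Tournament (suc m) = exhaustible-× (exhaustible-Vec exhaustible-Bool m) (exhaustible-Tournament m)

record IsStrictTotalᵇ {m} (R : Fin m → Fin m → Bool) : Set where
  field
    irrefl     : ∀ a → R a a ≡ false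
    complement : ∀ {a b} → a ≢ b → R b a ≡ not (R a b)
    transitive : ∀ {a b c} → R a b ≡ true → R b c ≡ true → R a c ≡ true

toRelation-toTournament : ∀ {m} (R : Fin m → Fin m → Bool) →
                          (∀ a → R a a ≡ false) → (∀ {a b} → a ≢ b → R b a ≡ not (R a b)) →
                          ∀ a b → toRelation (toTournament R) a b ≡ R a b
toRelation-toTournament R irrefl complement zero    zero    = sym (irrefl zero)
toRelation-toTournament R irrefl complement zero    (suc b) = lookup∘tabulate (R zero ∘ suc) b
toRelation-toTournament R irrefl complement (suc a) zero    =
  trans (cong not (lookup∘tabulate (R zero ∘ suc) a)) (sym (complement λ ()))
toRelation-toTournament R irrefl complement (suc a) (suc b) =
  toRelation-toTournament (λ a b → R (suc a) (suc b)) (irrefl ∘ suc)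
                          (λ a≢b → complement (a≢b ∘ suc-injective)) a b

transitiveᵇ : ∀ {m} → (Fin m → Fin m → Bool) → Bool
transitiveᵇ R = allFinᵇ λ a → allFinᵇ λ b → allFinᵇ λ c → R a b ∧ R b c ⇒ᵇ R a c

transitiveᵇ-complete : ∀ {m} (R : Fin m → Fin m → Bool) →
                       (∀ {a b c} → R a b ≡ true → R b c ≡ true → R a c ≡ true) → transitiveᵇ R ≡ true
transitiveᵇ-complete R transitive =
  allFinᵇ-complete (λ a → allFinᵇ λ b → allFinᵇ λ c → R a b ∧ R b c ⇒ᵇ R a c) λ a →
  allFinᵇ-complete (λ b → allFinᵇ λ c → R a b ∧ R b c ⇒ᵇ R a c) λ b →
  allFinᵇ-complete (λ c → R a b ∧ R b c ⇒ᵇ R a c) λ c →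
  ⇒ᵇ-intro λ ab∧bc → transitive (∧-conicalˡ (R a b) (R b c) ab∧bc) (∧-conicalʳ (R a b) (R b c) ab∧bc)

height : ∀ {m} → (Fin (suc m) → Fin (suc m) → Bool) → Fin (suc m) → ℕ
height R x = count (λ k → R (punchIn x k) x)

orderWeight : (Fin 5 → Fin 5 → Bool) → ℕ
orderWeight R = ∑[ x < 5 ] weight (height R x)

orderWeight-cong : {R S : Fin 5 → Fin 5 → Bool} → (∀ a b → R a b ≡ S a b) → orderWeight R ≡ orderWeight S
orderWeight-cong R≗S = sum-cong-≗ (λ x → cong weight (count-cong (λ k → R≗S (punchIn x k) x)))

lightIfTransitiveᵇ : Tournament 5 → Bool
lightIfTransitiveᵇ t = transitiveᵇ (toRelation t) ⇒ᵇ orderWeight (toRelation t) ≤ᵇ 7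

all-lightIfTransitive : allᵇ (exhaustible-Tournament 5) lightIfTransitiveᵇ ≡ true
all-lightIfTransitive = refl

strictTotal⇒orderWeight≤7 : (R : Fin 5 → Fin 5 → Bool) → IsStrictTotalᵇ R → orderWeight R ≤ 7
strictTotal⇒orderWeight≤7 R strictTotal =
  subst (_≤ 7) (orderWeight-cong R′≗R) (≤ᵇ≡true⇒≤ (orderWeight R′) 7
    (⇒ᵇ-elim (allᵇ-sound (exhaustible-Tournament 5) lightIfTransitiveᵇ all-lightIfTransitive t)
             (transitiveᵇ-complete R′ λ {a b c} ab bc →
                transport⁻¹ a c (IsStrictTotalᵇ.transitive strictTotal (transport a b ab) (transport b c bc)))))
  where
  open IsStrictTotalᵇ strictTotal using (irrefl; complement)
  t  = toTournament R
  R′ = toRelation t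
  R′≗R = toRelation-toTournament R irrefl complement
  transport : ∀ a b → R′ a b ≡ true → R a b ≡ true
  transport a b = trans (sym (R′≗R a b))
  transport⁻¹ : ∀ a b → R a b ≡ true → R′ a b ≡ true
  transport⁻¹ a b = trans (R′≗R a b)

does≡true⇒ : ∀ {P : Set} (P? : Dec P) → does P? ≡ true → P
does≡true⇒ (yes p) _ = p

<?-complement : ∀ {n} {x y : Fin n} → x ≢ y → does (y <? x) ≡ not (does (x <? y))
<?-complement {x = x} {y} x≢y with <-cmp x y
... | tri< x<y _ _ = trans (dec-false (y <? x) (<-asym x<y)) (cong not (sym (dec-true (x <? y) x<y)))
... | tri≈ _ x≡y _ = contradiction x≡y x≢y
... | tri> _ _ y<x = trans (dec-true (y <? x) y<x) (cong not (sym (dec-false (x <? y) (<-asym y<x))))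

<?-isStrictTotalᵇ : ∀ {m n} (v : Fin m → Fin n) → Injective _≡_ _≡_ v →
                    IsStrictTotalᵇ (λ a b → does (v a <? v b))
<?-isStrictTotalᵇ v v-injective = record
  { irrefl     = λ a → dec-false (v a <? v a) (<-irrefl refl)
  ; complement = λ a≢b → <?-complement (a≢b ∘ v-injective)
  ; transitive = λ {a} {b} {c} ab bc →
      dec-true (v a <? v c) (<-trans (does≡true⇒ (v a <? v b) ab) (does≡true⇒ (v b <? v c) bc))
  }

-- At least five orderings are needed

below : ∀ {n} → Ordering n → Fin n → Fin n → Bool
below φ a b = does (φ ⟨$⟩ʳ a <? φ ⟨$⟩ʳ b)

-- BetSat φ (triple a b c _ _ _) unfolds to Between φ a b c, which does not mention the
-- distinctness proofs and can therefore be decided triple by triple.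
Between : ∀ {n} → Ordering n → Fin n → Fin n → Fin n → Set
Between φ a b c =
  ((φ ⟨$⟩ʳ a) < (φ ⟨$⟩ʳ b) × (φ ⟨$⟩ʳ b) < (φ ⟨$⟩ʳ c))
  ⊎ ((φ ⟨$⟩ʳ c) < (φ ⟨$⟩ʳ b) × (φ ⟨$⟩ʳ b) < (φ ⟨$⟩ʳ a))

between⇒opposite-sides : ∀ {n} (φ : Ordering n) {a b c : Fin n} →
                         Between φ a b c → below φ a b ≢ below φ c b
between⇒opposite-sides φ {a} {b} {c} (inj₁ (a<b , b<c)) ab≡cb with () ←
  trans (sym (dec-true (φ ⟨$⟩ʳ a <? φ ⟨$⟩ʳ b) a<b))
        (trans ab≡cb (dec-false (φ ⟨$⟩ʳ c <? φ ⟨$⟩ʳ b) (<-asym b<c)))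
between⇒opposite-sides φ {a} {b} {c} (inj₂ (c<b , b<a)) ab≡cb with () ←
  trans (sym (dec-true (φ ⟨$⟩ʳ c <? φ ⟨$⟩ʳ b) c<b))
        (trans (sym ab≡cb) (dec-false (φ ⟨$⟩ʳ a <? φ ⟨$⟩ʳ b) (<-asym b<a)))

CoveredBy : ∀ {n k} → (Fin k → Ordering n) → Set
CoveredBy {n} φs = (c : Constraint n) → ∃ λ i → BetSat (φs i) c

clamp : ∀ {m k} → Fin m → Fin (suc k)
clamp {k = k} j = fromℕ< (s≤s (m⊓n≤n (toℕ j) k))

clamp-inject≤ : ∀ {m k} (i : Fin (suc k)) (k<m : suc k ≤ m) → clamp (inject≤ i k<m) ≡ i
clamp-inject≤ {k = k} i k<m = trans (fromℕ<-cong _ _ toℕ-clamp _ (toℕ<n i)) (fromℕ<-toℕ i (toℕ<n i))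
  where
  toℕ-clamp : toℕ (inject≤ i k<m) ⊓ k ≡ toℕ i
  toℕ-clamp = trans (cong (_⊓ k) (toℕ-inject≤ i k<m)) (m≤n⇒m⊓n≡m (toℕ≤pred[n] i))

∑-mono-≤ : ∀ {m} {f g : Fin m → ℕ} → (∀ i → f i ≤ g i) → ∑[ i < m ] f i ≤ ∑[ i < m ] g i
∑-mono-≤ {zero}  _   = z≤n
∑-mono-≤ {suc m} f≤g = +-mono-≤ (f≤g zero) (∑-mono-≤ (f≤g ∘ suc))

module _ {n} (5≤n : 5 ≤ n) where

  private
    ι : Fin 5 → Fin n
    ι a = inject≤ a 5≤n

    ι-injective : Injective _≡_ _≡_ ι
    ι-injective = inject≤-injective 5≤n 5≤n _ _

  relativeOrder : Ordering n → Fin 5 → Fin 5 → Bool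
  relativeOrder φ a b = below φ (ι a) (ι b)

  relativeOrder-isStrictTotalᵇ : ∀ φ → IsStrictTotalᵇ (relativeOrder φ)
  relativeOrder-isStrictTotalᵇ φ = <?-isStrictTotalᵇ ((φ ⟨$⟩ʳ_) ∘ ι) (ι-injective ∘ Injection.injective (↔⇒↣ φ))

  around : (x : Fin 5) {p q : Fin 4} → p ≢ q → Constraint n
  around x {p} {q} p≢q = triple (ι (punchIn x p)) (ι x) (ι (punchIn x q))
    (punchInᵢ≢i x p ∘ ι-injective)
    (p≢q ∘ punchIn-injective x p q ∘ ι-injective)
    (punchInᵢ≢i x q ∘ sym ∘ ι-injective)

  6≤columnWeight : (φs : Fin 4 → Ordering n) → CoveredBy φs →
                   ∀ x → 6 ≤ ∑[ j < 4 ] weight (height (relativeOrder (φs j)) x)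
  6≤columnWeight φs cover x = columnsSeparated⇒6≤tableWeight below-x separated
    where
    below-x : Fin 4 → Fin 4 → Bool
    below-x j k = relativeOrder (φs j) (punchIn x k) x
    separated : ColumnsSeparated below-x
    separated p≢q = let j , sat = cover (around x p≢q) in j , between⇒opposite-sides (φs j) sat

  no-cover-by-4 : (φs : Fin 4 → Ordering n) → ¬ CoveredBy φs
  no-cover-by-4 φs cover = ≤⇒≯ 30≤28 (n≤1+n 29)
    where
    open ≤-Reasoning
    w : Fin 4 → Fin 5 → ℕ
    w j x = weight (height (relativeOrder (φs j)) x)
    orderWeight≤7 : ∀ j → ∑[ x < 5 ] w j x ≤ 7
    orderWeight≤7 j = strictTotal⇒orderWeight≤7 (relativeOrder (φs j)) (relativeOrder-isStrictTotalᵇ (φs j))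
    30≤28 : 30 ≤ 28
    30≤28 = begin
      ∑[ x < 5 ] 6                ≤⟨ ∑-mono-≤ (6≤columnWeight φs cover) ⟩
      ∑[ x < 5 ] ∑[ j < 4 ] w j x ≡⟨ ∑-comm (λ x j → w j x) ⟩
      ∑[ j < 4 ] ∑[ x < 5 ] w j x ≤⟨ ∑-mono-≤ orderWeight≤7 ⟩
      ∑[ j < 4 ] 7                ∎

  no-cover-by-≤4 : ∀ {k} → k ≤ 4 → (φs : Fin k → Ordering n) → ¬ CoveredBy φs
  no-cover-by-≤4 {zero}  _   φs cover with () ← proj₁ (cover (around 0F {0F} {1F} λ ()))
  no-cover-by-≤4 {suc k} k<5 φs cover = no-cover-by-4 (φs ∘ clamp) λ c →
    let i , sat = cover c in inject≤ i k<5 , subst (λ i → BetSat (φs i) c) (sym (clamp-inject≤ i k<5)) sat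

  covering⇒5≤size : (k : ℕ) (S : OrderingSet n k) → Covers S → 5 ≤ k
  covering⇒5≤size k S cover with k ≤? 4
  ... | yes k≤4 = ⊥-elim (no-cover-by-≤4 k≤4 (member S) cover)
  ... | no  k≰4 = ≰⇒> k≰4

-- Five orderings suffice

-- The fallback y is never used for a table accepted by invertibleTable?.
preimage : ∀ {n} → Vec (Fin n) n → Fin n → Fin n
preimage t y with any? (λ i → lookup t i ≟ y)
... | yes (i , _) = i
... | no  _       = y

InvertibleTable : ∀ {n} → Vec (Fin n) n → Set
InvertibleTable t = (∀ y → lookup t (preimage t y) ≡ y) × (∀ x → preimage t (lookup t x) ≡ x)

invertibleTable? : ∀ {n} (t : Vec (Fin n) n) → Dec (InvertibleTable t)
invertibleTable? t = all? (λ y → lookup t (preimage t y) ≟ y)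
               ×-dec all? (λ x → preimage t (lookup t x) ≟ x)

fromTables : ∀ {n k} (ts : Vec (Vec (Fin n) n) k) → {True (all? (invertibleTable? ∘ lookup ts))} →
             Fin k → Ordering n
fromTables ts {invertible} i = permutation (lookup t) (preimage t) (proj₁ t-invertible) (proj₂ t-invertible)
  where
  t = lookup ts i
  t-invertible = toWitness invertible i

between? : ∀ {n} (φ : Ordering n) a b c → Dec (Between φ a b c)
between? φ a b c = ((_ <? _) ×-dec (_ <? _)) ⊎-dec ((_ <? _) ×-dec (_ <? _))

CoversTriples : ∀ {n k} → (Fin k → Ordering n) → Set
CoversTriples φs = ∀ a b c → a ≢ b → a ≢ c → b ≢ c → ∃ λ i → Between (φs i) a b c

coversTriples? : ∀ {n k} (φs : Fin k → Ordering n) → Dec (CoversTriples φs)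
coversTriples? φs =
  all? λ a → all? λ b → all? λ c →
    ¬? (a ≟ b) →-dec ¬? (a ≟ c) →-dec ¬? (b ≟ c) →-dec any? λ i → between? (φs i) a b c

Distinct : ∀ {n k} → (Fin k → Ordering n) → Set
Distinct φs = ∀ i j → SameOrdering (φs i) (φs j) → i ≡ j

distinct? : ∀ {n k} (φs : Fin k → Ordering n) → Dec (Distinct φs)
distinct? φs = all? λ i → all? λ j → all? (λ x → φs i ⟨$⟩ʳ x ≟ φs j ⟨$⟩ʳ x) →-dec (i ≟ j)

coveringSet : ∀ {n k} (φs : Fin k → Ordering n) → {True (distinct? φs)} → {True (coversTriples? φs)} →
              Σ (OrderingSet n k) Covers
coveringSet φs {distinct} {covers} =
  record { member = φs ; distinct = toWitness distinct } ,
  λ { (triple a b c a≢b a≢c b≢c) → toWitness covers a b c a≢b a≢c b≢c }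

-- Row i of each table lists φᵢ(0), φᵢ(1), …, the positions of the points in the i-th ordering.

orderings₅ : Fin 5 → Ordering 5
orderings₅ = fromTables
  ( (0F ∷ 1F ∷ 2F ∷ 3F ∷ 4F ∷ [])
  ∷ (1F ∷ 0F ∷ 4F ∷ 2F ∷ 3F ∷ [])
  ∷ (4F ∷ 0F ∷ 3F ∷ 2F ∷ 1F ∷ [])
  ∷ (1F ∷ 2F ∷ 0F ∷ 4F ∷ 3F ∷ [])
  ∷ (1F ∷ 2F ∷ 3F ∷ 0F ∷ 4F ∷ [])
  ∷ [])

orderings₆ : Fin 5 → Ordering 6
orderings₆ = fromTables
  ( (0F ∷ 1F ∷ 2F ∷ 3F ∷ 4F ∷ 5F ∷ [])
  ∷ (1F ∷ 0F ∷ 5F ∷ 2F ∷ 4F ∷ 3F ∷ [])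
  ∷ (4F ∷ 0F ∷ 3F ∷ 2F ∷ 1F ∷ 5F ∷ [])
  ∷ (1F ∷ 3F ∷ 0F ∷ 5F ∷ 4F ∷ 2F ∷ [])
  ∷ (1F ∷ 3F ∷ 4F ∷ 0F ∷ 5F ∷ 2F ∷ [])
  ∷ [])

orderings₇ : Fin 5 → Ordering 7
orderings₇ = fromTables
  ( (1F ∷ 2F ∷ 3F ∷ 4F ∷ 5F ∷ 6F ∷ 0F ∷ [])
  ∷ (1F ∷ 0F ∷ 6F ∷ 2F ∷ 5F ∷ 4F ∷ 3F ∷ [])
  ∷ (5F ∷ 0F ∷ 4F ∷ 3F ∷ 1F ∷ 6F ∷ 2F ∷ [])
  ∷ (1F ∷ 4F ∷ 0F ∷ 6F ∷ 5F ∷ 3F ∷ 2F ∷ [])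
  ∷ (1F ∷ 3F ∷ 4F ∷ 0F ∷ 5F ∷ 2F ∷ 6F ∷ [])
  ∷ [])

lemmaA2 : IsBet 5 5 × IsBet 6 5 × IsBet 7 5
lemmaA2 =
    (coveringSet orderings₅ , covering⇒5≤size (m≤m+n 5 0))
  , (coveringSet orderings₆ , covering⇒5≤size (m≤m+n 5 1))
  , (coveringSet orderings₇ , covering⇒5≤size (m≤m+n 5 2))
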